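{- Let $T$ be a balanced tree with total charge $k\ge1$ and degree distribution $(\lambda,\mu)$. Then its closure $\phi(T)$ is a $k$-leg map with degree distribution $(\lambda,\mu)$.
   Context: All maps are planar, connected, considered up to orientation-preserving homeomorphism, and bipartite: vertices are black or white and each edge joins a black and a white vertex. Maps may carry half-edges attached to single vertices and lying in the infinite face. A half-edge at a white vertex is a leaf; one at a black vertex is a bud. Maps are rooted at a half-edge. Degrees count edges and half-edges. The degree distribution $(\lambda,\mu)$ is the pair of multisets of degrees of white and of black vertices. A $k$-leg map has exactly $k$ leaves and no buds, and is rooted at one of its leaves. A tree is such a map with a single face. Its total charge is the number of leaves minus the number of buds, the root half-edge included. For a tree of total charge $k\ge1$, go counterclockwise around it and repeatedly match a bud immediately followed (among still unmatched half-edges in the cyclic order) by a leaf. The $k$ leaves left unmatched are single. A tree is balanced if it is rooted at a single leaf. The closure $\phi(T)$ of a balanced tree fuses every matched bud–leaf pair into an edge, drawn counterclockwise around the tree without crossings, and keeps the root unchanged. -}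

module Defs where

open import Data.Nat using (ℕ; zero; suc; _+_; _*_; _≤ᵇ_; _≡ᵇ_)
open import Data.Fin using (Fin; toℕ; _≟_)
open import Data.Bool using (Bool; true; false; _∧_; _∨_; not; if_then_else_)
open import Data.List using (List; []; _∷_; map; filter; upTo; allFin; reverse)
open import Data.Bool.ListAction using (any; all)
open import Data.Maybe using (Maybe; just; nothing)
open import Data.Product using (_×_; _,_; proj₁; proj₂; Σ)
open import Relation.Nullary using (¬_)
open import Relation.Nullary.Decidable using (⌊_⌋)
open import Relation.Binary.PropositionalEquality using (_≡_; _≢_)
open import Data.List.Membership.Propositional using (_∈_)

-- Every dart is either one side of an edge or a
-- half-edge.
--   σ     : rotation (counterclockwise) of the darts around their vertex;
--           vertices = cycles of σ, degree = length of the cycle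
--           (so edges AND half-edges are counted).
--   α     : edge involution; fixed points of α are the half-edges (legs).
--   white : colour of the vertex carrying the dart (true = white,
--           false = black).
--   root  : the root dart.
-- Faces are the cycles of  φ = σ ∘ α , which goes counterclockwise
-- around a face of the map (for a tree: counterclockwise around the tree).

record RawMap (n : ℕ) : Set where
  field
    σ     : Fin n → Fin n
    α     : Fin n → Fin n
    white : Fin n → Bool
    root  : Fin n

pow : {A : Set} → (A → A) → ℕ → A → A
pow p zero    d = d
pow p (suc i) d = p (pow p i d)

module _ {n : ℕ} where

  _==_ : Fin n → Fin n → Bool
  d == e = ⌊ d ≟ e ⌋

  countB : {A : Set} → (A → Bool) → List A → ℕ
  countB p []       = 0
  countB p (x ∷ xs) = if p x then suc (countB p xs) else countB p xs

  darts : List (Fin n)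
  darts = allFin n

  -- e lies in the orbit of d under p (orbits have size ≤ n)
  inOrbit : (Fin n → Fin n) → Fin n → Fin n → Bool
  inOrbit p d e = any (λ i → pow p i d == e) (upTo n)

  orbitSize : (Fin n → Fin n) → Fin n → ℕ
  orbitSize p d = countB (inOrbit p d) darts

  isOrbitMin : (Fin n → Fin n) → Fin n → Bool
  isOrbitMin p d = all (λ i → toℕ d ≤ᵇ toℕ (pow p i d)) (upTo n)

  cycles : (Fin n → Fin n) → ℕ
  cycles p = countB (isOrbitMin p) darts

  module _ (M : RawMap n) where
    open RawMap M

    φ : Fin n → Fin n
    φ d = σ (α d)

    isLeg : Fin n → Bool
    isLeg d = α d == d

    isLeaf : Fin n → Bool
    isLeaf d = isLeg d ∧ white d

    isBud : Fin n → Bool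
    isBud d = isLeg d ∧ not (white d)

    nLegs nLeaves nBuds nVertices nFaces : ℕ
    nLegs     = countB isLeg darts
    nLeaves   = countB isLeaf darts
    nBuds     = countB isBud darts
    nVertices = cycles σ
    nFaces    = cycles φ

    -- number of vertices of colour c and degree deg
    -- (this function is the degree distribution (λ,μ) as a pair of
    --  multisets, given by multiplicities)
    degCount : Bool → ℕ → ℕ
    degCount c deg =
      countB (λ d → isOrbitMin σ d ∧ (⌊ Data.Bool._≟_ (white d) c ⌋ ∧ (orbitSize σ d ≡ᵇ deg))) darts

    data Reach : Fin n → Fin n → Set where
      here  : ∀ {d} → Reach d d
      stepσ : ∀ {d e} → Reach (σ d) e → Reach d e
      stepα : ∀ {d e} → Reach (α d) e → Reach d e

    record IsMap : Set where
      field
        σ⁻¹        : Fin n → Fin n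
        σ-σ⁻¹      : ∀ d → σ (σ⁻¹ d) ≡ d
        σ⁻¹-σ      : ∀ d → σ⁻¹ (σ d) ≡ d
        α-invol    : ∀ d → α (α d) ≡ d
        white-σ    : ∀ d → white (σ d) ≡ white d
        bipartite  : ∀ d → α d ≢ d → white (α d) ≢ white d
        connected  : ∀ d e → Reach d e
        -- planarity (genus 0), Euler's formula V - E + F = 2 with
        -- E = (n - #legs)/2 edges:
        planar     : 2 * (nVertices + nFaces) + nLegs ≡ n + 4
        root-leg   : α root ≡ root
        -- all half-edges lie in the infinite face (the face of the root)
        legs-outer : ∀ d → α d ≡ d → inOrbit φ root d ≡ true

    IsTree : Set
    IsTree = IsMap × (nFaces ≡ 1)

    IsKLegMap : ℕ → Set
    IsKLegMap k = IsMap × (nLeaves ≡ k) × (nBuds ≡ 0) × (isLeaf root ≡ true)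

    HasCharge : ℕ → Set
    HasCharge k = nLeaves ≡ k + nBuds

    -- Matching of buds and leaves.
    -- Half-edges in counterclockwise order around the tree, starting at
    -- the root (the face of a tree visits every dart).
    legsInOrder : List (Fin n)
    legsInOrder = filter (λ d → isLeg d Data.Bool.≟ true)
                    (map (λ i → pow φ i root) (upTo n))

    findPair : List (Fin n) → Maybe (Fin n × Fin n × List (Fin n))
    findPair (x ∷ y ∷ xs) =
      if isBud x ∧ isLeaf y then just (x , y , xs)
      else consRest x (findPair (y ∷ xs))
      where
        consRest : Fin n → Maybe (Fin n × Fin n × List (Fin n))
                 → Maybe (Fin n × Fin n × List (Fin n))
        consRest x nothing              = nothing
        consRest x (just (b , l , rest)) = just (b , l , x ∷ rest)
    findPair _ = nothing

    cyclicFind : List (Fin n) → Maybe (Fin n × Fin n × List (Fin n))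
    cyclicFind L with findPair L
    ... | just r  = just r
    ... | nothing with L
    ...   | [] = nothing
    ...   | x ∷ xs with reverse xs
    ...     | []      = nothing
    ...     | z ∷ ys  = if isBud z ∧ isLeaf x
                          then just (z , x , reverse ys)
                          else nothing

    matchLoop : ℕ → List (Fin n) → List (Fin n × Fin n)
              → List (Fin n × Fin n) × List (Fin n)
    matchLoop zero    L acc = acc , L
    matchLoop (suc f) L acc with cyclicFind L
    ... | nothing            = acc , L
    ... | just (b , l , L')  = matchLoop f L' ((b , l) ∷ acc)

    matching : List (Fin n × Fin n) × List (Fin n)
    matching = matchLoop n legsInOrder []

    matchedPairs : List (Fin n × Fin n)
    matchedPairs = proj₁ matching

    unmatched : List (Fin n)
    unmatched = proj₂ matching

    Balanced : Set
    Balanced = (isLeaf root ≡ true) × (root ∈ unmatched)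

    partner : List (Fin n × Fin n) → Fin n → Maybe (Fin n)
    partner []             d = nothing
    partner ((b , l) ∷ ps) d =
      if d == b then just l else if d == l then just b else partner ps d

    -- closure: every matched bud–leaf pair becomes an edge; the rotation
    -- system (hence the counterclockwise, crossing-free drawing), the
    -- colours and the root are kept.
    closure : RawMap n
    closure = record
      { σ     = σ
      ; α     = λ d → closeα (partner matchedPairs d) d
      ; white = white
      ; root  = root
      }
      where
        closeα : Maybe (Fin n) → Fin n → Fin n
        closeα (just e) d = e
        closeα nothing  d = α d

  SameDegDist : RawMap n → RawMap n → Set
  SameDegDist M M' = ∀ c deg → degCount M c deg ≡ degCount M' c deg

-- The closure is built one matched pair at a time. When a bud b is followed, among the unmatched
-- half-edges of the root face, by a leaf l, that face reads root … b B l C with no half-edge in B;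
-- fusing b and l into an edge cuts it into the root face root … b C and a new face l B. Each fusion
-- thus keeps the vertices with their colours and rotations (hence the degree distribution), keeps
-- the edges bipartite (b is black, l is white), adds one face and removes two half-edges, so that
-- Euler's relation 2 (V + F) + #half-edges = n + 4 survives, and every remaining half-edge still
-- lies on the root face. The root is a single leaf, so it stays first among the unmatched
-- half-edges and no pair wraps around it; the procedure stops only when no bud is followed by a
-- leaf, which, a leaf being left, means that no bud is left. Every fusion used one leaf and one
-- bud, so exactly k leaves remain.

module Submission where

open import Defs
open import Data.Nat using (ℕ; zero; suc; _+_; _*_; _∸_; _≤_; _<_; z≤n; s≤s)
open import Data.Nat.Properties
  using ( ≤-trans; ≤-antisym; ≤-reflexive; ≤-pred; <-irrefl; <⇒≤; <⇒≱; n<1+n; m≤n⇒m≤1+n; n≤0⇒n≡0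
        ; m∸n≤m; m<n⇒0<n∸m; m+[n∸m]≡n; m∸n+n≡m; ≤ᵇ⇒≤; ≤⇒≤ᵇ; +-suc; +-identityʳ; +-cancelʳ-≡ )
open import Data.Nat.DivMod using (_%_; _/_; m≡m%n+[m/n]*n; m%n<n)
open import Data.Nat.Tactic.RingSolver using (solve-∀)
open import Data.Fin using (Fin; toℕ; _≟_)
open import Data.Fin.Properties using (pigeonhole; toℕ<n; toℕ-injective; injective⇒≤)
open import Data.Bool using (Bool; true; false; _∧_)
import Data.Bool as Bool
open import Data.Bool.Properties using (T-≡)
open import Data.Maybe using (Maybe; just; nothing)
open import Data.Product using (∃; ∃₂; _×_; _,_; proj₁; proj₂)
open import Data.Sum using (_⊎_; inj₁; inj₂)
open import Data.Empty using (⊥; ⊥-elim)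
open import Data.List
  using (List; []; _∷_; _++_; [_]; _∷ʳ_; length; filter; lookup; reverse; map; concat; upTo; applyUpTo; allFin
        ; initLast; _∷ʳ′_)
open import Data.List.Properties
  using ( ∷-injective; ++-assoc; ++-identityʳ; reverse-++; filter-accept; filter-reject; filter-++; length-filter
        ; length-map; length-upTo; map-applyUpTo )
open import Data.List.Extrema.Nat using (argmin; argmin-sel; f[argmin]≤f[⊤]; f[argmin]≤f[xs])
open import Data.List.Membership.Propositional using (_∈_; _∉_; lose)
open import Data.List.Membership.Propositional.Properties
  using (∈-∃++; ∈-++⁺ˡ; ∈-++⁺ʳ; ∈-++⁻; ∈-filter⁺; ∈-filter⁻; ∈-map⁺; ∈-map⁻; ∈-upTo⁺; ∈-allFin)
open import Data.List.Relation.Unary.Any using (here; there; index; satisfied)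
open import Data.List.Relation.Unary.Any.Properties using (lookup-index; any⁺; any⁻; reverse⁻)
open import Data.List.Relation.Unary.All using (All; []; _∷_)
import Data.List.Relation.Unary.All as All
import Data.List.Relation.Unary.All.Properties as Allₚ
import Data.List.Relation.Unary.AllPairs as AllPairs
open import Data.List.Relation.Unary.Unique.Propositional using (Unique; []; _∷_)
open import Data.List.Relation.Unary.Unique.Propositional.Properties using (filter⁺; allFin⁺; applyUpTo⁺₁)
open import Data.List.Relation.Binary.Subset.Propositional using (_⊆_)
import Data.List.Relation.Binary.Subset.Propositional.Properties as Subset
open import Data.List.Relation.Binary.Permutation.Propositional
  using (_↭_; prep; swap; ↭-sym; ↭-trans; ↭-reflexive; ↭⇒↭ₛ) renaming (refl to ↭-refl; trans to ↭-step)
open import Data.List.Relation.Binary.Permutation.Propositional.Properties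
  using (∈-resp-↭; shift; ↭-length; ++-comm; ++⁺ˡ; ++⁺ʳ)
import Data.List.Relation.Binary.Permutation.Setoid.Properties as ↭ₛ
open import Function using (id; case_of_)
open import Function.Bundles using (Equivalence)
open import Relation.Nullary.Decidable using (isYes≗does; dec-true; dec-false; toWitness; fromWitness; toSum)
open import Relation.Binary.PropositionalEquality
  using (_≡_; _≢_; refl; sym; trans; cong; cong₂; subst; subst₂; setoid; module ≡-Reasoning)

-- Duplicate-free lists, counting and filtering

module _ {A : Set} where

  Unique-resp-↭ : {xs ys : List A} → xs ↭ ys → Unique xs → Unique ys
  Unique-resp-↭ p = ↭ₛ.Unique-resp-↭ (setoid A) (↭⇒↭ₛ p)

  Unique-head : {x : A} {xs : List A} → Unique (x ∷ xs) → x ∉ xs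
  Unique-head (x≢ ∷ _) x∈ = All.lookup x≢ x∈ refl

  Unique-[_] : (x : A) → Unique [ x ]
  Unique-[ x ] = [] ∷ []

  Unique-++⁻ : (xs : List A) {ys : List A} → Unique (xs ++ ys) → Unique xs × Unique ys
  Unique-++⁻ []       u          = [] , u
  Unique-++⁻ (x ∷ xs) (x≢ ∷ u) = (Allₚ.++⁻ˡ xs x≢ ∷ proj₁ (Unique-++⁻ xs u)) , proj₂ (Unique-++⁻ xs u)

  Unique-mid : (xs : List A) {x : A} {ys : List A} → Unique (xs ++ x ∷ ys) → x ∉ xs ++ ys
  Unique-mid xs {x} {ys} u = Unique-head (Unique-resp-↭ (shift x xs ys) u)

  ∈-drop-head : {x y : A} {xs : List A} → y ∈ x ∷ xs → y ≢ x → y ∈ xs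
  ∈-drop-head (here y≡x) y≢x = ⊥-elim (y≢x y≡x)
  ∈-drop-head (there y∈) _   = y∈

  ↭-unique : (xs ys : List A) → Unique xs → Unique ys →
             (∀ {x} → x ∈ xs → x ∈ ys) → (∀ {x} → x ∈ ys → x ∈ xs) → xs ↭ ys
  ↭-unique []       []       _ _ _ _ = ↭-refl
  ↭-unique []       (y ∷ ys) _ _ _ ys⊆xs with ys⊆xs (here refl)
  ... | ()
  ↭-unique (x ∷ xs) ys uxs uys xs⊆ys ys⊆xs with ∈-∃++ (xs⊆ys (here refl))
  ... | ys₁ , ys₂ , refl =
    ↭-trans (prep x (↭-unique xs (ys₁ ++ ys₂) (AllPairs.tail uxs) (AllPairs.tail uys′) ⊆₁ ⊆₂))
            (↭-sym (shift x ys₁ ys₂))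
    where
      uys′ = Unique-resp-↭ (shift x ys₁ ys₂) uys
      ⊆₁ : ∀ {z} → z ∈ xs → z ∈ ys₁ ++ ys₂
      ⊆₁ z∈ = ∈-drop-head (∈-resp-↭ (shift x ys₁ ys₂) (xs⊆ys (there z∈)))
                (λ { refl → Unique-head uxs z∈ })
      ⊆₂ : ∀ {z} → z ∈ ys₁ ++ ys₂ → z ∈ xs
      ⊆₂ z∈ = ∈-drop-head (ys⊆xs (∈-resp-↭ (↭-sym (shift x ys₁ ys₂)) (there z∈)))
                (λ { refl → Unique-head uys′ z∈ })

  shift₂ : (xs : List A) (y : A) (ys : List A) (z : A) (zs : List A) →
           xs ++ y ∷ ys ++ z ∷ zs ↭ y ∷ z ∷ xs ++ ys ++ zs
  shift₂ xs y ys z zs = ↭-trans (shift y xs (ys ++ z ∷ zs)) (prep y (↭-trans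
    (↭-reflexive (sym (++-assoc xs ys (z ∷ zs))))
    (↭-trans (shift z (xs ++ ys) zs) (↭-reflexive (cong (z ∷_) (++-assoc xs ys zs))))))

  Unique-apart₂ : (xs : List A) {y : A} (ys : List A) {z : A} (zs : List A) → Unique (xs ++ y ∷ ys ++ z ∷ zs) →
                  y ≢ z × y ∉ xs ++ ys ++ zs × z ∉ xs ++ ys ++ zs
  Unique-apart₂ xs ys zs u with Unique-resp-↭ (shift₂ xs _ ys _ zs) u
  ... | u′ = (λ y≡z → Unique-head u′ (here y≡z)) , (λ y∈ → Unique-head u′ (there y∈)) ,
             Unique-head (AllPairs.tail u′)

  Unique-++-disjoint : (xs : List A) {ys : List A} → Unique (xs ++ ys) → ∀ {x y} → x ∈ xs → y ∈ ys → x ≢ y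
  Unique-++-disjoint (_ ∷ xs) (x≢ ∷ _) (here refl) y∈ = All.lookup x≢ (∈-++⁺ʳ xs y∈)
  Unique-++-disjoint (_ ∷ xs) (_ ∷ u)  (there x∈)  y∈ = Unique-++-disjoint xs u x∈ y∈

∃-minimiser : {A : Set} (f : A → ℕ) (x : A) (xs : List A) →
              ∃ λ m → m ∈ x ∷ xs × (∀ {y} → y ∈ x ∷ xs → f m ≤ f y)
∃-minimiser f x xs = argmin f x xs , argmin∈ , argmin≤
  where
    argmin∈ : argmin f x xs ∈ x ∷ xs
    argmin∈ with argmin-sel f x xs
    ... | inj₁ m≡x  = here m≡x
    ... | inj₂ m∈xs = there m∈xs
    argmin≤ : ∀ {y} → y ∈ x ∷ xs → f (argmin f x xs) ≤ f y
    argmin≤ (here refl) = f[argmin]≤f[⊤] {f = f} x xs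
    argmin≤ (there y∈)  = All.lookup (f[argmin]≤f[xs] {f = f} x xs) y∈

complete⇒≤length : {n : ℕ} (xs : List (Fin n)) → (∀ x → x ∈ xs) → n ≤ length xs
complete⇒≤length xs complete = injective⇒≤ {f = λ x → index (complete x)} index-injective
  where
    index-injective : ∀ {x y} → index (complete x) ≡ index (complete y) → x ≡ y
    index-injective {x} {y} eq =
      trans (lookup-index (complete x)) (trans (cong (lookup xs) eq) (sym (lookup-index (complete y))))

reverse-++-∷ʳ : {A : Set} (xs ys : List A) (z : A) → reverse (xs ++ ys ∷ʳ z) ≡ z ∷ reverse (xs ++ ys)
reverse-++-∷ʳ xs ys z = trans (cong reverse (sym (++-assoc xs ys [ z ]))) (reverse-++ (xs ++ ys) [ z ])

-- countB takes an implicit dart count that it never uses and that cannot be inferred, so it is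
-- passed explicitly.
module _ {n : ℕ} {A : Set} where

  countB-++ : (p : A → Bool) (xs ys : List A) → countB {n} p (xs ++ ys) ≡ countB {n} p xs + countB {n} p ys
  countB-++ p []       ys = refl
  countB-++ p (x ∷ xs) ys with p x
  ... | true  = cong suc (countB-++ p xs ys)
  ... | false = countB-++ p xs ys

  countB-↭ : (p : A → Bool) {xs ys : List A} → xs ↭ ys → countB {n} p xs ≡ countB {n} p ys
  countB-↭ p ↭-refl = refl
  countB-↭ p (prep x q) with p x
  ... | true  = cong suc (countB-↭ p q)
  ... | false = countB-↭ p q
  countB-↭ p (swap x y q) with p x | p y
  ... | true  | true  = cong (λ c → suc (suc c)) (countB-↭ p q)
  ... | true  | false = cong suc (countB-↭ p q)
  ... | false | true  = cong suc (countB-↭ p q)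
  ... | false | false = countB-↭ p q
  countB-↭ p (↭-step q r) = trans (countB-↭ p q) (countB-↭ p r)

  countB-cong : {p q : A → Bool} (xs : List A) → (∀ x → p x ≡ q x) → countB {n} p xs ≡ countB {n} q xs
  countB-cong {p} {q} []       _   = refl
  countB-cong {p} {q} (x ∷ xs) p≗q with p x | q x | p≗q x
  ... | true  | true  | _ = cong suc (countB-cong xs p≗q)
  ... | false | false | _ = countB-cong xs p≗q

  countB-none : (p : A → Bool) (xs : List A) → (∀ {x} → x ∈ xs → p x ≡ false) → countB {n} p xs ≡ 0
  countB-none p []       _    = refl
  countB-none p (x ∷ xs) none with p x | none (here refl)
  ... | false | _ = countB-none p xs (λ x∈ → none (there x∈))

  countB≡0⇒false : (p : A → Bool) (xs : List A) → countB {n} p xs ≡ 0 → ∀ {x} → x ∈ xs → p x ≡ false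
  countB≡0⇒false p (y ∷ xs) c x∈ with p y in py
  countB≡0⇒false p (y ∷ xs) _ (here refl) | false = py
  countB≡0⇒false p (y ∷ xs) c (there x∈)  | false = countB≡0⇒false p xs c x∈

  countB≤length : (p : A → Bool) (xs : List A) → countB {n} p xs ≤ length xs
  countB≤length p []       = z≤n
  countB≤length p (x ∷ xs) with p x
  ... | true  = s≤s (countB≤length p xs)
  ... | false = m≤n⇒m≤1+n (countB≤length p xs)

  countB-pos : (p : A → Bool) {xs : List A} {x : A} → x ∈ xs → p x ≡ true → 1 ≤ countB {n} p xs
  countB-pos p {y ∷ xs} (here refl) px rewrite px = s≤s z≤n
  countB-pos p {y ∷ xs} (there x∈)  px with p y
  ... | true  = s≤s z≤n
  ... | false = countB-pos p x∈ px

  countB≥2 : (p : A → Bool) {xs : List A} {x y : A} → x ∈ xs → y ∈ xs → x ≢ y →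
             p x ≡ true → p y ≡ true → 2 ≤ countB {n} p xs
  countB≥2 p (here refl) (here refl) x≢y _  _  = ⊥-elim (x≢y refl)
  countB≥2 p (here refl) (there y∈)  _   px py rewrite px = s≤s (countB-pos p y∈ py)
  countB≥2 p (there x∈)  (here refl) _   px py rewrite py = s≤s (countB-pos p x∈ px)
  countB≥2 p {z ∷ _} (there x∈) (there y∈) x≢y px py with p z
  ... | true  = m≤n⇒m≤1+n (countB≥2 p x∈ y∈ x≢y px py)
  ... | false = countB≥2 p x∈ y∈ x≢y px py

  countB-extract₂ : (p : A → Bool) (xs : List A) (y z : A) (zs : List A) →
                    countB {n} p (xs ++ y ∷ z ∷ zs) ≡ countB {n} p (y ∷ z ∷ []) + countB {n} p (xs ++ zs)
  countB-extract₂ p xs y z zs = trans (countB-↭ p (shift₂ xs y [] z zs)) (countB-++ p (y ∷ z ∷ []) (xs ++ zs))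

-- Written with ≟ true, as in legsInOrder, so that legsInOrder T is literally a select.
select : {A : Set} → (A → Bool) → List A → List A
select p = filter (λ x → p x Bool.≟ true)

module _ {A : Set} (p : A → Bool) where

  private p? = λ x → p x Bool.≟ true

  ∈-select⁺ : ∀ {x xs} → x ∈ xs → p x ≡ true → x ∈ select p xs
  ∈-select⁺ = ∈-filter⁺ p?

  ∈-select⁻ : ∀ {x xs} → x ∈ select p xs → x ∈ xs × p x ≡ true
  ∈-select⁻ = ∈-filter⁻ p?

  select-accept : ∀ {x xs} → p x ≡ true → select p (x ∷ xs) ≡ x ∷ select p xs
  select-accept = filter-accept p?

  select-reject : ∀ {x xs} → p x ≡ false → select p (x ∷ xs) ≡ select p xs
  select-reject px = filter-reject p? (λ px≡true → case trans (sym px) px≡true of λ ())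

  select-++ : ∀ xs ys → select p (xs ++ ys) ≡ select p xs ++ select p ys
  select-++ = filter-++ p?

  Unique-select : ∀ {xs} → Unique xs → Unique (select p xs)
  Unique-select = filter⁺ p?

  length-select : ∀ xs → length (select p xs) ≤ length xs
  length-select = length-filter p?

module _ {A : Set} where

  select-cong : {p q : A → Bool} (xs : List A) → (∀ {x} → x ∈ xs → p x ≡ q x) → select p xs ≡ select q xs
  select-cong {p} {q} []       _   = refl
  select-cong {p} {q} (x ∷ xs) p≗q with p x | q x | p≗q (here refl)
  ... | true  | true  | _ = cong (x ∷_) (select-cong xs (λ x∈ → p≗q (there x∈)))
  ... | false | false | _ = select-cong xs (λ x∈ → p≗q (there x∈))

  select-split : (p : A → Bool) (xs : List A) {ys₁ : List A} {y : A} {ys₂ : List A} →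
                 select p xs ≡ ys₁ ++ y ∷ ys₂ →
                 ∃₂ λ xs₁ xs₂ → xs ≡ xs₁ ++ y ∷ xs₂ × select p xs₁ ≡ ys₁ × select p xs₂ ≡ ys₂
  select-split p []       {[]}    ()
  select-split p []       {_ ∷ _} ()
  select-split p (x ∷ xs) {ys₁} eq with p x in px
  select-split p (x ∷ xs) {[]}      refl | true = [] , xs , refl , refl , refl
  select-split p (x ∷ xs) {_ ∷ ys₁} eq   | true with ∷-injective eq
  ... | refl , eq′ with select-split p xs eq′
  ...   | xs₁ , xs₂ , refl , sel₁ , sel₂ =
    x ∷ xs₁ , xs₂ , refl , trans (select-accept p px) (cong (x ∷_) sel₁) , sel₂
  select-split p (x ∷ xs) eq | false with select-split p xs eq
  ... | xs₁ , xs₂ , refl , sel₁ , sel₂ = x ∷ xs₁ , xs₂ , refl , trans (select-reject p px) sel₁ , sel₂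

module _ {n : ℕ} {A : Set} where

  countB≡length-select : (p : A → Bool) (xs : List A) → countB {n} p xs ≡ length (select p xs)
  countB≡length-select p []       = refl
  countB≡length-select p (x ∷ xs) with p x
  ... | true  = cong suc (countB≡length-select p xs)
  ... | false = countB≡length-select p xs

  countB-select : (p q : A → Bool) (xs : List A) → (∀ {x} → p x ≡ true → q x ≡ true) →
                  countB {n} p (select q xs) ≡ countB {n} p xs
  countB-select p q []       _   = refl
  countB-select p q (x ∷ xs) p⇒q with q x in qx
  ... | true with p x
  ...   | true  = cong suc (countB-select p q xs p⇒q)
  ...   | false = countB-select p q xs p⇒q
  countB-select p q (x ∷ xs) p⇒q | false with p x in px
  ... | false = countB-select p q xs p⇒q
  ... | true with () ← trans (sym (p⇒q px)) qx

  countB-sameElements : (p : A → Bool) {xs ys : List A} → Unique xs → Unique ys →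
                        (∀ {x} → x ∈ xs → x ∈ ys) → (∀ {x} → x ∈ ys → x ∈ xs) →
                        countB {n} p xs ≡ countB {n} p ys
  countB-sameElements p uxs uys xs⊆ys ys⊆xs = countB-↭ {n} p (↭-unique _ _ uxs uys xs⊆ys ys⊆xs)

  countB≡length : (p : A → Bool) {xs ys : List A} → Unique xs → Unique ys →
                  (∀ {x} → x ∈ ys → x ∈ xs × p x ≡ true) →
                  (∀ {x} → x ∈ xs → p x ≡ true → x ∈ ys) →
                  countB {n} p xs ≡ length ys
  countB≡length p {xs} {ys} uxs uys ys⊆ xs⊆ = trans (countB≡length-select p xs)
    (↭-length (↭-unique _ _ (Unique-select p uxs) uys
      (λ x∈ → let (x∈xs , px) = ∈-select⁻ p x∈ in xs⊆ x∈xs px)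
      (λ x∈ → let (x∈xs , px) = ys⊆ x∈ in ∈-select⁺ p x∈xs px)))

-- Iterates, chains and cycles

module _ {A : Set} (p : A → A) where
  open ≡-Reasoning

  pow-+ : (i j : ℕ) (x : A) → pow p (i + j) x ≡ pow p i (pow p j x)
  pow-+ zero    j x = refl
  pow-+ (suc i) j x = cong p (pow-+ i j x)

  pow-periodic : ∀ {t x} → pow p t x ≡ x → ∀ s → pow p (s * t) x ≡ x
  pow-periodic         _ zero    = refl
  pow-periodic {t} {x} e (suc s) = begin
    pow p (t + s * t) x         ≡⟨ pow-+ t (s * t) x ⟩
    pow p t (pow p (s * t) x)   ≡⟨ cong (pow p t) (pow-periodic e s) ⟩
    pow p t x                   ≡⟨ e ⟩
    x                           ∎

  pow-mod : ∀ {t x} → 1 ≤ t → pow p t x ≡ x → ∀ i → ∃ λ r → r < t × pow p i x ≡ pow p r x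
  pow-mod {suc t} {x} _ e i = i % suc t , m%n<n i (suc t) , (begin
    pow p i x                                         ≡⟨ cong (λ j → pow p j x) (m≡m%n+[m/n]*n i (suc t)) ⟩
    pow p (i % suc t + (i / suc t) * suc t) x         ≡⟨ pow-+ (i % suc t) _ x ⟩
    pow p (i % suc t) (pow p ((i / suc t) * suc t) x) ≡⟨ cong (pow p (i % suc t)) (pow-periodic e (i / suc t)) ⟩
    pow p (i % suc t) x                               ∎)

Chain : {A : Set} → (A → A) → A → List A → A → Set
Chain p a []       c = p a ≡ c
Chain p a (b ∷ bs) c = p a ≡ b × Chain p b bs c

Cycle : {A : Set} → (A → A) → List A → Set
Cycle p []       = ⊥
Cycle p (a ∷ as) = Chain p a as a

module _ {A : Set} {p : A → A} where

  chain-++⁻ : ∀ {a} xs {y ys c} → Chain p a (xs ++ y ∷ ys) c → Chain p a xs y × Chain p y ys c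
  chain-++⁻ []       (pa≡y , ch) = pa≡y , ch
  chain-++⁻ (x ∷ xs) (pa≡x , ch) = (pa≡x , proj₁ (chain-++⁻ xs ch)) , proj₂ (chain-++⁻ xs ch)

  chain-++⁺ : ∀ {a} xs {y ys c} → Chain p a xs y → Chain p y ys c → Chain p a (xs ++ y ∷ ys) c
  chain-++⁺ []       pa≡y          ch = pa≡y , ch
  chain-++⁺ (x ∷ xs) (pa≡x , ch₁) ch = pa≡x , chain-++⁺ xs ch₁ ch

  chain-step : ∀ {a} xs {c y} → Chain p a xs c → y ∈ a ∷ xs → p y ∈ xs ++ [ c ]
  chain-step []       pa≡c         (here refl) = here pa≡c
  chain-step (b ∷ bs) (pa≡b , _)   (here refl) = here pa≡b
  chain-step (b ∷ bs) (_    , ch)  (there y∈)  = there (chain-step bs ch y∈)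

  cycle-closed : ∀ {C} → Cycle p C → ∀ {y} → y ∈ C → p y ∈ C
  cycle-closed {a ∷ as} cyc y∈ = ∈-resp-↭ (++-comm as [ a ]) (chain-step as cyc y∈)

  chain-applyUpTo : (h : ℕ → A) → (∀ i → p (h i) ≡ h (suc i)) →
                    ∀ k → Chain p (h 0) (applyUpTo (λ i → h (suc i)) k) (h (suc k))
  chain-applyUpTo h step zero    = step 0
  chain-applyUpTo h step (suc k) = step 0 , chain-applyUpTo (λ i → h (suc i)) (λ i → step (suc i)) k

  cycle-pow : ∀ {C} → Cycle p C → ∀ {y} → y ∈ C → ∀ i → pow p i y ∈ C
  cycle-pow cyc y∈ zero    = y∈
  cycle-pow cyc y∈ (suc i) = cycle-closed cyc (cycle-pow cyc y∈ i)

module _ {A : Set} {p : A → A} where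

  chain-cong : {q : A → A} {a a′ : A} (xs : List A) {c : A} → q a′ ≡ p a → (∀ {x} → x ∈ xs → q x ≡ p x) →
               Chain p a xs c → Chain q a′ xs c
  chain-cong []       qa′≡pa _   pa≡c         = trans qa′≡pa pa≡c
  chain-cong (b ∷ bs) qa′≡pa q≗p (pa≡b , ch) =
    trans qa′≡pa pa≡b , chain-cong bs (q≗p (here refl)) (λ x∈ → q≗p (there x∈)) ch

  cycle-cong : {q : A → A} {C : List A} → (∀ {x} → x ∈ C → q x ≡ p x) → Cycle p C → Cycle q C
  cycle-cong {C = a ∷ as} q≗p = chain-cong as (q≗p (here refl)) (λ x∈ → q≗p (there x∈))

  cycle-split : {q : A → A} {a b l : A} (as bs cs : List A) → Unique (a ∷ as ++ b ∷ bs ++ l ∷ cs) →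
                q b ≡ p l → q l ≡ p b → (∀ {x} → x ≢ b → x ≢ l → q x ≡ p x) →
                Cycle p (a ∷ as ++ b ∷ bs ++ l ∷ cs) → Cycle q (a ∷ as ++ b ∷ cs) × Cycle q (l ∷ bs)
  cycle-split {q} {a} {b} {l} as bs cs u qb≡pl ql≡pb q≗p cyc
    with chain-++⁻ as cyc
  ... | a→b , b→a with chain-++⁻ bs b→a
  ...   | b→l , l→a =
    chain-++⁺ as (chain-cong as (agree (here refl)) (λ x∈ → agree (there (∈-++⁺ˡ x∈))) a→b)
                 (chain-cong cs qb≡pl (λ x∈ → agree (∈-++⁺ʳ (a ∷ as) (∈-++⁺ʳ bs x∈))) l→a) ,
    chain-cong bs ql≡pb (λ x∈ → agree (∈-++⁺ʳ (a ∷ as) (∈-++⁺ˡ x∈))) b→l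
    where
      agree : ∀ {x} → x ∈ (a ∷ as) ++ bs ++ cs → q x ≡ p x
      agree x∈ with Unique-apart₂ (a ∷ as) bs cs u
      ... | _ , b∉ , l∉ = q≗p (λ { refl → b∉ x∈ }) (λ { refl → l∉ x∈ })

record IsCycleDecomposition {A : Set} (p : A → A) (Cs : List (List A)) : Set where
  field
    isCycle  : All (Cycle p) Cs
    unique   : Unique (concat Cs)
    complete : ∀ x → x ∈ concat Cs

module _ {A : Set} {p : A → A} where

  cycles-cong : {q : A → A} (Cs : List (List A)) → (∀ {x} → x ∈ concat Cs → q x ≡ p x) →
                All (Cycle p) Cs → All (Cycle q) Cs
  cycles-cong []       _   []           = []
  cycles-cong (C ∷ Cs) q≗p (cyc ∷ cycs) =
    cycle-cong {C = C} (λ x∈ → q≗p (∈-++⁺ˡ x∈)) cyc ∷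
    cycles-cong Cs (λ x∈ → q≗p (∈-++⁺ʳ C x∈)) cycs

  decomposition-cong : {q : A → A} {Cs : List (List A)} → (∀ x → q x ≡ p x) →
                       IsCycleDecomposition p Cs → IsCycleDecomposition q Cs
  decomposition-cong {Cs = Cs} q≗p dec = record
    { isCycle = cycles-cong Cs (λ {x} _ → q≗p x) isCycle ; unique = unique ; complete = complete }
    where open IsCycleDecomposition dec

  decomposition-split : {q : A → A} {a b l : A} (as bs cs : List A) {Cs : List (List A)} →
                        q b ≡ p l → q l ≡ p b → (∀ {x} → x ≢ b → x ≢ l → q x ≡ p x) →
                        IsCycleDecomposition p ((a ∷ as ++ b ∷ bs ++ l ∷ cs) ∷ Cs) →
                        IsCycleDecomposition q ((a ∷ as ++ b ∷ cs) ∷ (l ∷ bs) ∷ Cs)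
  decomposition-split {q} {a} {b} {l} as bs cs {Cs} qb≡pl ql≡pb q≗p dec = record
    { isCycle  = outer′ ∷ inner′ ∷ cycles-cong Cs others (All.tail isCycle)
    ; unique   = Unique-resp-↭ reorder unique
    ; complete = λ x → ∈-resp-↭ reorder (complete x)
    }
    where
      open IsCycleDecomposition dec
      uouter = proj₁ (Unique-++⁻ (a ∷ as ++ b ∷ bs ++ l ∷ cs) unique)
      split = cycle-split as bs cs uouter qb≡pl ql≡pb q≗p (All.head isCycle)
      outer′ = proj₁ split
      inner′ = proj₂ split
      b∈ : b ∈ a ∷ as ++ b ∷ bs ++ l ∷ cs
      b∈ = there (∈-++⁺ʳ as (here refl))
      l∈ : l ∈ a ∷ as ++ b ∷ bs ++ l ∷ cs
      l∈ = there (∈-++⁺ʳ as (there (∈-++⁺ʳ bs (here refl))))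
      others : ∀ {x} → x ∈ concat Cs → q x ≡ p x
      others x∈ = q≗p (λ x≡b → Unique-++-disjoint _ unique b∈ x∈ (sym x≡b))
                      (λ x≡l → Unique-++-disjoint _ unique l∈ x∈ (sym x≡l))
      swap-blocks : bs ++ l ∷ cs ↭ cs ++ l ∷ bs
      swap-blocks = ↭-trans (++-comm bs (l ∷ cs)) (↭-sym (shift l cs bs))
      reorder : (a ∷ as ++ b ∷ bs ++ l ∷ cs) ++ concat Cs ↭ (a ∷ as ++ b ∷ cs) ++ (l ∷ bs) ++ concat Cs
      reorder = ↭-trans (++⁺ʳ (concat Cs) (↭-trans (prep a (++⁺ˡ as (prep b swap-blocks)))
                                                   (↭-reflexive (cong (a ∷_) (sym (++-assoc as (b ∷ cs) (l ∷ bs)))))))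
                        (↭-reflexive (++-assoc (a ∷ as ++ b ∷ cs) (l ∷ bs) (concat Cs)))

-- Orbits of a permutation of Fin n

module Orbits {n : ℕ} (p : Fin n → Fin n) (p-injective : ∀ {x y} → p x ≡ p y → x ≡ y) where
  open ≡-Reasoning

  pow-injective : ∀ i {x y} → pow p i x ≡ pow p i y → x ≡ y
  pow-injective zero    eq = eq
  pow-injective (suc i) eq = pow-injective i (p-injective eq)

  pow-∸ : ∀ {i j x} → i ≤ j → pow p i x ≡ pow p j x → pow p (j ∸ i) x ≡ x
  pow-∸ {i} {j} {x} i≤j eq = sym (pow-injective i (begin
    pow p i x                 ≡⟨ eq ⟩
    pow p j x                 ≡⟨ cong (λ k → pow p k x) (sym (m+[n∸m]≡n i≤j)) ⟩
    pow p (i + (j ∸ i)) x     ≡⟨ pow-+ p i (j ∸ i) x ⟩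
    pow p i (pow p (j ∸ i) x) ∎))

  pow-period : (x : Fin n) → ∃ λ t → 1 ≤ t × t ≤ n × pow p t x ≡ x
  pow-period x with pigeonhole (n<1+n n) (λ (i : Fin (suc n)) → pow p (toℕ i) x)
  ... | i , j , i<j , eq =
    toℕ j ∸ toℕ i , m<n⇒0<n∸m i<j , ≤-trans (m∸n≤m (toℕ j) (toℕ i)) (≤-pred (toℕ<n j)) , pow-∸ (<⇒≤ i<j) eq

  infix 4 _↝_
  _↝_ : Fin n → Fin n → Set
  x ↝ y = ∃ λ i → pow p i x ≡ y

  ↝-bounded : ∀ {x y} → x ↝ y → ∃ λ i → i < n × pow p i x ≡ y
  ↝-bounded {x} (i , refl) with pow-period x
  ... | t , 1≤t , t≤n , pᵗx≡x with pow-mod p 1≤t pᵗx≡x i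
  ...   | r , r<t , eq = r , ≤-trans r<t t≤n , sym eq

  ↝-refl : ∀ {x} → x ↝ x
  ↝-refl = 0 , refl

  ↝-trans : ∀ {x y z} → x ↝ y → y ↝ z → x ↝ z
  ↝-trans {x} (i , refl) (j , refl) = j + i , pow-+ p j i x

  ↝-sym : ∀ {x y} → x ↝ y → y ↝ x
  ↝-sym {x} (i , refl) with pow-period x
  ... | t , 1≤t , _ , pᵗx≡x with pow-mod p 1≤t pᵗx≡x i
  ...   | r , r<t , eq = t ∸ r , (begin
    pow p (t ∸ r) (pow p i x) ≡⟨ cong (pow p (t ∸ r)) eq ⟩
    pow p (t ∸ r) (pow p r x) ≡⟨ sym (pow-+ p (t ∸ r) r x) ⟩
    pow p (t ∸ r + r) x       ≡⟨ cong (λ k → pow p k x) (m∸n+n≡m (<⇒≤ r<t)) ⟩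
    pow p t x                 ≡⟨ pᵗx≡x ⟩
    x                         ∎)

  inOrbit⇒↝ : ∀ {x y} → inOrbit p x y ≡ true → x ↝ y
  inOrbit⇒↝ {x} {y} h with satisfied (any⁻ _ (upTo n) (Equivalence.from T-≡ h))
  ... | i , pⁱx≡y = i , toWitness pⁱx≡y

  ↝⇒inOrbit : ∀ {x y} → x ↝ y → inOrbit p x y ≡ true
  ↝⇒inOrbit {x} {y} x↝y with ↝-bounded x↝y
  ... | i , i<n , pⁱx≡y = Equivalence.to T-≡ (any⁺ _ (lose (∈-upTo⁺ i<n) (fromWitness pⁱx≡y)))

  isOrbitMin⇒≤ : ∀ {x y} → isOrbitMin p x ≡ true → x ↝ y → toℕ x ≤ toℕ y
  isOrbitMin⇒≤ {x} h x↝y with ↝-bounded x↝y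
  ... | i , i<n , refl = ≤ᵇ⇒≤ _ _ (All.lookup (Allₚ.all⁺ _ (upTo n) (Equivalence.from T-≡ h)) (∈-upTo⁺ i<n))

  ≤⇒isOrbitMin : ∀ {x} → (∀ {y} → x ↝ y → toℕ x ≤ toℕ y) → isOrbitMin p x ≡ true
  ≤⇒isOrbitMin {x} h =
    Equivalence.to T-≡ (Allₚ.all⁻ _ {xs = upTo n} (All.tabulate (λ {i} _ → ≤⇒≤ᵇ (h (i , refl)))))

  chain-↝ : ∀ {a} xs {c y} → Chain p a xs c → y ∈ a ∷ xs → a ↝ y
  chain-↝ xs       _            (here refl) = ↝-refl
  chain-↝ (b ∷ bs) (pa≡b , ch) (there y∈)  = ↝-trans (1 , pa≡b) (chain-↝ bs ch y∈)

  cycle-↝ : ∀ {C x y} → Cycle p C → x ∈ C → y ∈ C → x ↝ y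
  cycle-↝ {a ∷ as} cyc x∈ y∈ = ↝-trans (↝-sym (chain-↝ as cyc x∈)) (chain-↝ as cyc y∈)

  cycle-↝-closed : ∀ {C y z} → Cycle p C → y ∈ C → y ↝ z → z ∈ C
  cycle-↝-closed cyc y∈ (i , refl) = cycle-pow cyc y∈ i

  countB-isOrbitMin-cycle : ∀ {C} → Cycle p C → Unique C → countB {n} (isOrbitMin p) C ≡ 1
  countB-isOrbitMin-cycle {a ∷ as} cyc u with ∃-minimiser toℕ a as
  ... | m , m∈ , m≤ = countB≡length {n} (isOrbitMin p) u Unique-[ m ] m-min min-m
    where
      m-min : ∀ {x} → x ∈ [ m ] → x ∈ a ∷ as × isOrbitMin p x ≡ true
      m-min (here refl) = m∈ , ≤⇒isOrbitMin (λ m↝y → m≤ (cycle-↝-closed cyc m∈ m↝y))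
      min-m : ∀ {x} → x ∈ a ∷ as → isOrbitMin p x ≡ true → x ∈ [ m ]
      min-m x∈ x-min = here (toℕ-injective (≤-antisym (isOrbitMin⇒≤ x-min (cycle-↝ cyc x∈ m∈)) (m≤ x∈)))

  countB-isOrbitMin-cycles : ∀ Cs → All (Cycle p) Cs → Unique (concat Cs) →
                             countB {n} (isOrbitMin p) (concat Cs) ≡ length Cs
  countB-isOrbitMin-cycles []       []           _ = refl
  countB-isOrbitMin-cycles (C ∷ Cs) (cyc ∷ cycs) u = trans (countB-++ {n} (isOrbitMin p) C (concat Cs))
    (cong₂ _+_ (countB-isOrbitMin-cycle cyc (proj₁ (Unique-++⁻ C u)))
               (countB-isOrbitMin-cycles Cs cycs (proj₂ (Unique-++⁻ C u))))

  cycles≡length : ∀ {Cs} → IsCycleDecomposition p Cs → cycles p ≡ length Cs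
  cycles≡length {Cs} dec =
    trans (countB-sameElements {n} (isOrbitMin p) (allFin⁺ n) unique (λ _ → complete _) (λ _ → ∈-allFin _))
          (countB-isOrbitMin-cycles Cs isCycle unique)
    where open IsCycleDecomposition dec

  orbitMin : ∀ x → ∃ λ m → x ↝ m × isOrbitMin p m ≡ true
  orbitMin x with ∃-minimiser toℕ x (map (λ i → pow p i x) (upTo n))
  ... | m , m∈ , m≤ =
    m , listed⇒↝ m∈ , ≤⇒isOrbitMin (λ m↝y → m≤ (↝⇒listed (↝-trans (listed⇒↝ m∈) m↝y)))
    where
      ↝⇒listed : ∀ {y} → x ↝ y → y ∈ x ∷ map (λ i → pow p i x) (upTo n)
      ↝⇒listed x↝y with ↝-bounded x↝y
      ... | i , i<n , refl = there (∈-map⁺ _ (∈-upTo⁺ i<n))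
      listed⇒↝ : ∀ {y} → y ∈ x ∷ map (λ i → pow p i x) (upTo n) → x ↝ y
      listed⇒↝ (here refl) = ↝-refl
      listed⇒↝ (there y∈) with ∈-map⁻ _ y∈
      ... | i , _ , refl = i , refl

module SingleCycle {m : ℕ} (p : Fin (suc m) → Fin (suc m)) (p-injective : ∀ {x y} → p x ≡ p y → x ≡ y)
                   (single : cycles p ≡ 1) (x : Fin (suc m)) where
  open Orbits p p-injective

  orbit : List (Fin (suc m))
  orbit = map (λ i → pow p i x) (upTo (suc m))

  ↝-total : ∀ y → x ↝ y
  ↝-total y with inOrbit p x y in x~y
  ... | true  = inOrbit⇒↝ x~y
  -- otherwise the orbits of x and y have distinct minima, one for each of two cycles
  ... | false with orbitMin x | orbitMin y
  ...   | mx , x↝mx , mx-min | my , y↝my , my-min = ⊥-elim (<-irrefl refl (≤-trans two-minima (≤-reflexive single)))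
    where
      mx≢my : mx ≢ my
      mx≢my refl with () ← trans (sym (↝⇒inOrbit (↝-trans x↝mx (↝-sym y↝my)))) x~y
      two-minima : 2 ≤ cycles p
      two-minima = countB≥2 {suc m} (isOrbitMin p) (∈-allFin mx) (∈-allFin my) mx≢my mx-min my-min

  period≥ : ∀ {t} → 1 ≤ t → pow p t x ≡ x → suc m ≤ t
  period≥ {t} 1≤t pᵗx≡x =
    subst (suc m ≤_) (trans (length-map _ (upTo t)) (length-upTo t)) (complete⇒≤length _ listed)
    where
      listed : ∀ y → y ∈ map (λ i → pow p i x) (upTo t)
      listed y with ↝-total y
      ... | i , refl with pow-mod p 1≤t pᵗx≡x i
      ...   | r , r<t , eq = subst (_∈ _) (sym eq) (∈-map⁺ _ (∈-upTo⁺ r<t))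

  pow-order : pow p (suc m) x ≡ x
  pow-order with pow-period x
  ... | t , 1≤t , t≤n , pᵗx≡x with ≤-antisym t≤n (period≥ 1≤t pᵗx≡x)
  ...   | refl = pᵗx≡x

  orbit-unique : Unique orbit
  orbit-unique = subst Unique (sym (map-applyUpTo id _ (suc m))) (applyUpTo⁺₁ _ (suc m) distinct)
    where
      distinct : ∀ {i j} → i < j → j < suc m → pow p i x ≢ pow p j x
      distinct {i} {j} i<j j<n eq =
        <⇒≱ j<n (≤-trans (period≥ (m<n⇒0<n∸m i<j) (pow-∸ (<⇒≤ i<j) eq)) (m∸n≤m j i))

  orbit-complete : ∀ y → y ∈ orbit
  orbit-complete y with ↝-bounded (↝-total y)
  ... | i , i<n , refl = ∈-map⁺ _ (∈-upTo⁺ i<n)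

  orbit-cycle : Cycle p orbit
  orbit-cycle = subst₂ (Chain p x) (sym (map-applyUpTo suc (λ i → pow p i x) m)) pow-order
                       (chain-applyUpTo (λ i → pow p i x) (λ _ → refl) m)

  orbit-decomposition : IsCycleDecomposition p [ orbit ]
  orbit-decomposition = record
    { isCycle  = orbit-cycle ∷ []
    ; unique   = subst Unique (sym (++-identityʳ orbit)) orbit-unique
    ; complete = λ y → subst (y ∈_) (sym (++-identityʳ orbit)) (orbit-complete y)
    }

-- Half-edges and the matching procedure

module Matching {n : ℕ} (T : RawMap n) where

  Leg Leaf Bud : Fin n → Set
  Leg  d = isLeg  T d ≡ true
  Leaf d = isLeaf T d ≡ true
  Bud  d = isBud  T d ≡ true

  leaf⇒white : ∀ {d} → Leaf d → RawMap.white T d ≡ true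
  leaf⇒white {d} _ with isLeg T d | RawMap.white T d
  ... | true | true = refl

  bud⇒black : ∀ {d} → Bud d → RawMap.white T d ≡ false
  bud⇒black {d} _ with isLeg T d | RawMap.white T d
  ... | true | false = refl

  leaf⇒¬bud : ∀ {d} → Leaf d → isBud T d ≡ false
  leaf⇒¬bud {d} _ with isLeg T d | RawMap.white T d
  ... | true | true = refl

  bud⇒¬leaf : ∀ {d} → Bud d → isLeaf T d ≡ false
  bud⇒¬leaf {d} _ with isLeg T d | RawMap.white T d
  ... | true | false = refl

  leg⇒leaf⊎bud : ∀ {d} → Leg d → Leaf d ⊎ Bud d
  leg⇒leaf⊎bud {d} leg with isLeg T d | RawMap.white T d
  ... | true | true  = inj₁ refl
  ... | true | false = inj₂ refl

  leaf⇒leg : ∀ {d} → Leaf d → Leg d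
  leaf⇒leg {d} _ with isLeg T d | RawMap.white T d
  ... | true | true = refl

  bud⇒leg : ∀ {d} → Bud d → Leg d
  bud⇒leg {d} _ with isLeg T d | RawMap.white T d
  ... | true | false = refl

  findPair-just : ∀ L {b l R} → findPair T L ≡ just (b , l , R) →
                  ∃₂ λ L₁ L₂ → L ≡ L₁ ++ b ∷ l ∷ L₂ × R ≡ L₁ ++ L₂ × Bud b × Leaf l
  findPair-just (x ∷ y ∷ xs) eq with isBud T x ∧ isLeaf T y in bx∧ly
  findPair-just (x ∷ y ∷ xs) refl | true with isBud T x | isLeaf T y
  ... | true | true = [] , xs , refl , refl , refl , refl
  findPair-just (x ∷ y ∷ xs) eq | false with findPair T (y ∷ xs) in fp
  findPair-just (x ∷ y ∷ xs) refl | false | just _ with findPair-just (y ∷ xs) fp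
  ... | L₁ , L₂ , eq , refl , bud , leaf = x ∷ L₁ , L₂ , cong (x ∷_) eq , refl , bud , leaf

  findPair-nothing⇒sorted : ∀ L → All Leg L → findPair T L ≡ nothing →
                            ∃₂ λ F B → L ≡ F ++ B × All Leaf F × All Bud B
  findPair-nothing⇒sorted []       _          _ = [] , [] , refl , [] , []
  findPair-nothing⇒sorted (x ∷ []) (leg ∷ []) _ with leg⇒leaf⊎bud leg
  ... | inj₁ leaf = [ x ] , [] , refl , leaf ∷ [] , []
  ... | inj₂ bud  = [] , [ x ] , refl , [] , bud ∷ []
  findPair-nothing⇒sorted (x ∷ y ∷ xs) (leg ∷ legs) fp with isBud T x ∧ isLeaf T y in bx∧ly
  ... | false with findPair T (y ∷ xs) in fp′
  ...   | nothing with findPair-nothing⇒sorted (y ∷ xs) legs fp′ | leg⇒leaf⊎bud leg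
  ...     | F , B , eq , leaves , buds | inj₁ leaf = x ∷ F , B , cong (x ∷_) eq , leaf ∷ leaves , buds
  ...     | [] , B , eq , _ , buds     | inj₂ bud  = [] , x ∷ B , cong (x ∷_) eq , [] , bud ∷ buds
  ...     | f ∷ F , B , eq , leaf ∷ _ , _ | inj₂ bud
            with refl ← proj₁ (∷-injective eq) with () ← trans (sym bx∧ly) (cong₂ _∧_ bud leaf)

  cyclicFind-just : ∀ L {b l R} → cyclicFind T L ≡ just (b , l , R) →
                    findPair T L ≡ just (b , l , R) ⊎ ∃ λ L′ → L ≡ l ∷ L′ × R ⊆ L′
  cyclicFind-just (x ∷ xs) eq with findPair T (x ∷ xs)
  ... | just _  = inj₁ eq
  ... | nothing with reverse xs in rev
  ...   | z ∷ ys with isBud T z ∧ isLeaf T x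
  cyclicFind-just (x ∷ xs) refl | nothing | z ∷ ys | true =
    inj₂ (xs , refl , λ d∈ → reverse⁻ (subst (_ ∈_) (sym rev) (there (reverse⁻ d∈))))

  cyclicFind-⊆ : ∀ L {b l R} → cyclicFind T L ≡ just (b , l , R) → R ⊆ L
  cyclicFind-⊆ L eq with cyclicFind-just L eq
  ... | inj₂ (L′ , refl , R⊆L′) = Subset.⊆-trans R⊆L′ (Subset.xs⊆x∷xs L′ _)
  ... | inj₁ fp with findPair-just L fp
  ...   | L₁ , L₂ , refl , refl , _ = Subset.++⁺ʳ L₁ (Subset.xs⊆ys++xs L₂ (_ ∷ _ ∷ []))

  matchLoop-⊆ : ∀ fuel L acc → proj₂ (matchLoop T fuel L acc) ⊆ L
  matchLoop-⊆ zero       L acc = Subset.⊆-refl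
  matchLoop-⊆ (suc fuel) L acc with cyclicFind T L in cf
  ... | nothing          = Subset.⊆-refl
  ... | just (b , l , R) = Subset.⊆-trans (matchLoop-⊆ fuel R ((b , l) ∷ acc)) (cyclicFind-⊆ L cf)

  cyclicFind-nothing⇒¬wrap : ∀ {x} xs {z ys} → cyclicFind T (x ∷ xs) ≡ nothing → reverse xs ≡ z ∷ ys →
                             Bud z → Leaf x → ⊥
  cyclicFind-nothing⇒¬wrap {x} xs cf rev bud leaf with findPair T (x ∷ xs)
  ... | nothing with reverse xs | rev
  ...   | _ | refl rewrite bud | leaf with () ← cf

  cyclicFind-nothing⇒findPair-nothing : ∀ L → cyclicFind T L ≡ nothing → findPair T L ≡ nothing
  cyclicFind-nothing⇒findPair-nothing L cf with findPair T L
  ... | nothing = refl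

  cyclicFind-nothing⇒no-buds : ∀ L → All Leg L → 1 ≤ countB {n} (isLeaf T) L → cyclicFind T L ≡ nothing →
                               countB {n} (isBud T) L ≡ 0
  cyclicFind-nothing⇒no-buds L legs leaf∈L cf
    with findPair-nothing⇒sorted L legs (cyclicFind-nothing⇒findPair-nothing L cf)
  ... | F , B , refl , leaves , buds with initLast B
  ...   | [] = countB-none {n} (isBud T) (F ++ []) (λ d∈ → leaf⇒¬bud (All.lookup (Allₚ.++⁺ leaves []) d∈))
  ...   | B₀ ∷ʳ′ z with F
  ...     | [] = ⊥-elim (<-irrefl refl (subst (1 ≤_) no-leaves leaf∈L))
    where no-leaves = countB-none {n} (isLeaf T) (B₀ ∷ʳ z) (λ d∈ → bud⇒¬leaf (All.lookup buds d∈))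
  ...     | x ∷ F′ = ⊥-elim (cyclicFind-nothing⇒¬wrap (F′ ++ B₀ ∷ʳ z) cf (reverse-++-∷ʳ F′ B₀ z)
                                                   (All.head (Allₚ.++⁻ʳ B₀ buds)) (All.head leaves))

  length≡leaves+buds : ∀ L → All Leg L → length L ≡ countB {n} (isLeaf T) L + countB {n} (isBud T) L
  length≡leaves+buds []       []           = refl
  length≡leaves+buds (x ∷ xs) (leg ∷ legs) with leg⇒leaf⊎bud leg
  ... | inj₁ leaf rewrite leaf | leaf⇒¬bud leaf = cong suc (length≡leaves+buds xs legs)
  ... | inj₂ bud  rewrite bud | bud⇒¬leaf bud =
    trans (cong suc (length≡leaves+buds xs legs)) (sym (+-suc _ _))

-- Partial closures

module _ {n : ℕ} where

  ==-refl : (d : Fin n) → (d == d) ≡ true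
  ==-refl d = trans (isYes≗does (d ≟ d)) (dec-true (d ≟ d) refl)

  ==-≢ : {d e : Fin n} → d ≢ e → (d == e) ≡ false
  ==-≢ {d} {e} d≢e = trans (isYes≗does (d ≟ e)) (dec-false (d ≟ e) d≢e)

  ==⇒≡ : {d e : Fin n} → (d == e) ≡ true → d ≡ e
  ==⇒≡ d==e = toWitness (Equivalence.from T-≡ d==e)

module Gluing {n : ℕ} (T : RawMap n) where
  open RawMap T

  Pairs : Set
  Pairs = List (Fin n × Fin n)

  fuse : Maybe (Fin n) → Fin n → Fin n
  fuse (just e) _ = e
  fuse nothing  d = α d

  αᶜ : Pairs → Fin n → Fin n
  αᶜ ps d = fuse (partner T ps d) d

  φᶜ : Pairs → Fin n → Fin n
  φᶜ ps d = σ (αᶜ ps d)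

  isLegᶜ : Pairs → Fin n → Bool
  isLegᶜ ps d = αᶜ ps d == d

  α-closure : ∀ d → RawMap.α (closure T) d ≡ αᶜ (matchedPairs T) d
  α-closure d with partner T (matchedPairs T) d
  ... | just _  = refl
  ... | nothing = refl

  αᶜ-∷-bud : ∀ ps b l → αᶜ ((b , l) ∷ ps) b ≡ l
  αᶜ-∷-bud ps b l rewrite ==-refl b = refl

  αᶜ-∷-leaf : ∀ ps {b l} → b ≢ l → αᶜ ((b , l) ∷ ps) l ≡ b
  αᶜ-∷-leaf ps {b} {l} b≢l rewrite ==-≢ (λ l≡b → b≢l (sym l≡b)) | ==-refl l = refl

  αᶜ-∷-other : ∀ ps {b l d} → d ≢ b → d ≢ l → αᶜ ((b , l) ∷ ps) d ≡ αᶜ ps d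
  αᶜ-∷-other ps d≢b d≢l rewrite ==-≢ d≢b | ==-≢ d≢l = refl

  record IsGluing (ps : Pairs) : Set where
    field
      involutive : ∀ d → αᶜ ps (αᶜ ps d) ≡ d
      bipartite  : ∀ d → αᶜ ps d ≢ d → white (αᶜ ps d) ≢ white d
      extends    : ∀ d → α d ≢ d → αᶜ ps d ≡ α d

  module Fusing {ps : Pairs} {b l : Fin n} (αb≡b : αᶜ ps b ≡ b) (αl≡l : αᶜ ps l ≡ l) (b≢l : b ≢ l) where

    ps′ : Pairs
    ps′ = (b , l) ∷ ps

    φᶜ-bud : φᶜ ps′ b ≡ φᶜ ps l
    φᶜ-bud = cong σ (trans (αᶜ-∷-bud ps b l) (sym αl≡l))

    φᶜ-leaf : φᶜ ps′ l ≡ φᶜ ps b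
    φᶜ-leaf = cong σ (trans (αᶜ-∷-leaf ps b≢l) (sym αb≡b))

    φᶜ-other : ∀ {d} → d ≢ b → d ≢ l → φᶜ ps′ d ≡ φᶜ ps d
    φᶜ-other d≢b d≢l = cong σ (αᶜ-∷-other ps d≢b d≢l)

    isLegᶜ-bud : isLegᶜ ps′ b ≡ false
    isLegᶜ-bud = trans (cong (_== b) (αᶜ-∷-bud ps b l)) (==-≢ (λ l≡b → b≢l (sym l≡b)))

    isLegᶜ-leaf : isLegᶜ ps′ l ≡ false
    isLegᶜ-leaf = trans (cong (_== l) (αᶜ-∷-leaf ps b≢l)) (==-≢ b≢l)

    isLegᶜ-other : ∀ {d} → d ≢ b → d ≢ l → isLegᶜ ps′ d ≡ isLegᶜ ps d
    isLegᶜ-other d≢b d≢l = cong (_== _) (αᶜ-∷-other ps d≢b d≢l)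

    isGluing : IsGluing ps → white b ≢ white l → IsGluing ps′
    isGluing G wb≢wl = record { involutive = involutive′ ; bipartite = bipartite′ ; extends = extends′ }
      where
        open IsGluing G
        fixed-apart : ∀ {d e} → αᶜ ps e ≡ e → d ≢ e → αᶜ ps d ≢ e
        fixed-apart {d} αe≡e d≢e αd≡e = d≢e (trans (sym (involutive d)) (trans (cong (αᶜ ps) αd≡e) αe≡e))
        involutive′ : ∀ d → αᶜ ps′ (αᶜ ps′ d) ≡ d
        involutive′ d with toSum (d ≟ b) | toSum (d ≟ l)
        ... | inj₁ refl | _         = trans (cong (αᶜ ps′) (αᶜ-∷-bud ps b l)) (αᶜ-∷-leaf ps b≢l)
        ... | inj₂ _    | inj₁ refl = trans (cong (αᶜ ps′) (αᶜ-∷-leaf ps b≢l)) (αᶜ-∷-bud ps b l)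
        ... | inj₂ d≢b  | inj₂ d≢l  = trans (cong (αᶜ ps′) (αᶜ-∷-other ps d≢b d≢l))
          (trans (αᶜ-∷-other ps (fixed-apart αb≡b d≢b) (fixed-apart αl≡l d≢l)) (involutive d))
        bipartite′ : ∀ d → αᶜ ps′ d ≢ d → white (αᶜ ps′ d) ≢ white d
        bipartite′ d with toSum (d ≟ b) | toSum (d ≟ l)
        ... | inj₁ refl | _         rewrite αᶜ-∷-bud ps b l       = λ _ wl≡wb → wb≢wl (sym wl≡wb)
        ... | inj₂ _    | inj₁ refl rewrite αᶜ-∷-leaf ps b≢l      = λ _ → wb≢wl
        ... | inj₂ d≢b  | inj₂ d≢l  rewrite αᶜ-∷-other ps d≢b d≢l = bipartite d
        extends′ : ∀ d → α d ≢ d → αᶜ ps′ d ≡ α d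
        extends′ d αd≢d with toSum (d ≟ b) | toSum (d ≟ l)
        ... | inj₁ refl | _         = ⊥-elim (αd≢d (trans (sym (extends d αd≢d)) αb≡b))
        ... | inj₂ _    | inj₁ refl = ⊥-elim (αd≢d (trans (sym (extends d αd≢d)) αl≡l))
        ... | inj₂ d≢b  | inj₂ d≢l  = trans (αᶜ-∷-other ps d≢b d≢l) (extends d αd≢d)

module PartialClosure {n : ℕ} (T : RawMap n) where
  open RawMap T
  open Matching T
  open Gluing T

  -- root ∷ outer is the root face, read counterclockwise from the root; inner holds the faces
  -- closed by the fused pairs.
  record Invariant (ps : Pairs) (L : List (Fin n)) : Set where
    field
      gluing      : IsGluing ps
      outer       : List (Fin n)
      inner       : List (List (Fin n))
      faces       : IsCycleDecomposition (φᶜ ps) ((root ∷ outer) ∷ inner)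
      #inner      : length inner ≡ length ps
      legs-order  : L ≡ select (isLegᶜ ps) (root ∷ outer)
      legs⊆outer  : ∀ {d} → isLegᶜ ps d ≡ true → d ∈ root ∷ outer
      leaves-used : countB {n} (isLeaf T) L + length ps ≡ countB {n} (isLeaf T) (legsInOrder T)
      buds-used   : countB {n} (isBud T) L + length ps ≡ countB {n} (isBud T) (legsInOrder T)

  module _ {ps L} (I : Invariant ps L) where
    open Invariant I

    outer-unique : Unique (root ∷ outer)
    outer-unique = proj₁ (Unique-++⁻ (root ∷ outer) (IsCycleDecomposition.unique faces))

    L-unique : Unique L
    L-unique = subst Unique (sym legs-order) (Unique-select (isLegᶜ ps) outer-unique)

    L-isLegᶜ : ∀ {d} → d ∈ L → isLegᶜ ps d ≡ true
    L-isLegᶜ d∈ = proj₂ (∈-select⁻ (isLegᶜ ps) (subst (_ ∈_) legs-order d∈))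

    isLegᶜ⇒isLeg : ∀ {d} → isLegᶜ ps d ≡ true → Leg d
    isLegᶜ⇒isLeg {d} leg with toSum (α d ≟ d)
    ... | inj₁ αd≡d = trans (cong (_== d) αd≡d) (==-refl d)
    ... | inj₂ αd≢d = ⊥-elim (αd≢d (trans (sym (IsGluing.extends gluing d αd≢d)) (==⇒≡ leg)))

    L-legs : All Leg L
    L-legs = All.tabulate (λ d∈ → isLegᶜ⇒isLeg (L-isLegᶜ d∈))

    root-first : root ∈ L → ∃ λ L′ → L ≡ root ∷ L′
    root-first root∈ = _ , trans legs-order (select-accept (isLegᶜ ps) (L-isLegᶜ root∈))

    isLegᶜ⇒∈ : ∀ {d} → isLegᶜ ps d ≡ true → d ∈ L
    isLegᶜ⇒∈ leg = subst (_ ∈_) (sym legs-order) (∈-select⁺ (isLegᶜ ps) (legs⊆outer leg) leg)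

    countB-isLegᶜ : countB {n} (isLegᶜ ps) (allFin n) ≡ length L
    countB-isLegᶜ =
      countB≡length {n} (isLegᶜ ps) (allFin⁺ n) L-unique (λ d∈ → ∈-allFin _ , L-isLegᶜ d∈) (λ _ → isLegᶜ⇒∈)

    root∉tail : ∀ {x L′} → L ≡ x ∷ L′ → root ∉ L′
    root∉tail L≡ root∈L′ with root-first (subst (root ∈_) (sym L≡) (there root∈L′))
    ... | _ , L≡′ with ∷-injective (trans (sym L≡) L≡′)
    ...   | refl , refl = Unique-head (subst Unique L≡ L-unique) root∈L′

    root≢bud : ∀ {L₁ b l L₂} → L ≡ L₁ ++ b ∷ l ∷ L₂ → root ∈ L₁ ++ L₂ → root ≢ b
    root≢bud {L₁} {b} {l} {L₂} refl root∈ refl =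
      Unique-mid L₁ L-unique (Subset.++⁺ʳ L₁ (Subset.xs⊆x∷xs L₂ l) root∈)

    outer-split : ∀ {L₁ b l L₂} → L ≡ L₁ ++ b ∷ l ∷ L₂ → root ≢ b →
                  ∃₂ λ A B → ∃ λ C → outer ≡ A ++ b ∷ B ++ l ∷ C ×
                    select (isLegᶜ ps) (root ∷ A) ≡ L₁ × select (isLegᶜ ps) B ≡ [] × select (isLegᶜ ps) C ≡ L₂
    outer-split L≡ root≢b with select-split (isLegᶜ ps) (root ∷ outer) (trans (sym legs-order) L≡)
    ... | [] , _ , eq , _ , _ = ⊥-elim (root≢b (proj₁ (∷-injective eq)))
    ... | _ ∷ A , Q , eq , selA , selQ with ∷-injective eq
    ...   | refl , outer≡ with select-split (isLegᶜ ps) Q {[]} selQ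
    ...     | B , C , refl , selB , selC = A , B , C , outer≡ , selA , selB , selC

  module Step {ps L₁ b l L₂} (I : Invariant ps (L₁ ++ b ∷ l ∷ L₂)) (bud : Bud b) (leaf : Leaf l)
              {A B C : List (Fin n)} (outer≡ : Invariant.outer I ≡ A ++ b ∷ B ++ l ∷ C)
              (selA : select (isLegᶜ ps) (root ∷ A) ≡ L₁) (selB : select (isLegᶜ ps) B ≡ [])
              (selC : select (isLegᶜ ps) C ≡ L₂) where
    open Invariant I
    open ≡-Reasoning

    αb≡b : αᶜ ps b ≡ b
    αb≡b = ==⇒≡ (L-isLegᶜ I (∈-++⁺ʳ L₁ (here refl)))

    αl≡l : αᶜ ps l ≡ l
    αl≡l = ==⇒≡ (L-isLegᶜ I (∈-++⁺ʳ L₁ (there (here refl))))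

    b≢l : b ≢ l
    b≢l refl with () ← trans (sym (leaf⇒¬bud leaf)) bud

    open Fusing {ps} αb≡b αl≡l b≢l

    colours-differ : white b ≢ white l
    colours-differ wb≡wl with () ← trans (sym (bud⇒black bud)) (trans wb≡wl (leaf⇒white leaf))

    face-unique : Unique (root ∷ A ++ b ∷ B ++ l ∷ C)
    face-unique = subst (λ o → Unique (root ∷ o)) outer≡ (outer-unique I)

    apart : ∀ {d} → d ∈ (root ∷ A) ++ B ++ C → d ≢ b × d ≢ l
    apart d∈ with Unique-apart₂ (root ∷ A) B C face-unique
    ... | _ , b∉ , l∉ = (λ { refl → b∉ d∈ }) , (λ { refl → l∉ d∈ })

    faces′ : IsCycleDecomposition (φᶜ ps′) ((root ∷ A ++ b ∷ C) ∷ (l ∷ B) ∷ inner)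
    faces′ = decomposition-split A B C φᶜ-bud φᶜ-leaf φᶜ-other
               (subst (λ o → IsCycleDecomposition (φᶜ ps) ((root ∷ o) ∷ inner)) outer≡ faces)

    legs-order′ : L₁ ++ L₂ ≡ select (isLegᶜ ps′) (root ∷ A ++ b ∷ C)
    legs-order′ = sym (begin
      select (isLegᶜ ps′) ((root ∷ A) ++ b ∷ C)            ≡⟨ select-++ (isLegᶜ ps′) (root ∷ A) (b ∷ C) ⟩
      select (isLegᶜ ps′) (root ∷ A) ++ select (isLegᶜ ps′) (b ∷ C)
        ≡⟨ cong₂ _++_ (select-cong (root ∷ A) (λ d∈ → agree (∈-++⁺ˡ d∈)))
                      (select-reject (isLegᶜ ps′) isLegᶜ-bud) ⟩
      select (isLegᶜ ps) (root ∷ A) ++ select (isLegᶜ ps′) C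
        ≡⟨ cong₂ _++_ selA
                      (trans (select-cong C (λ d∈ → agree (∈-++⁺ʳ (root ∷ A) (∈-++⁺ʳ B d∈)))) selC) ⟩
      L₁ ++ L₂                                            ∎)
      where
        agree : ∀ {d} → d ∈ (root ∷ A) ++ B ++ C → isLegᶜ ps′ d ≡ isLegᶜ ps d
        agree d∈ = isLegᶜ-other (proj₁ (apart d∈)) (proj₂ (apart d∈))

    -- b and l are consecutive among the legs of the root face, so the new face l ∷ B carries no leg.
    legs⊆outer′ : ∀ {d} → isLegᶜ ps′ d ≡ true → d ∈ root ∷ A ++ b ∷ C
    legs⊆outer′ {d} leg′ with toSum (d ≟ b) | toSum (d ≟ l)
    ... | inj₁ refl | _         with () ← trans (sym leg′) isLegᶜ-bud
    ... | inj₂ _    | inj₁ refl with () ← trans (sym leg′) isLegᶜ-leaf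
    ... | inj₂ d≢b  | inj₂ d≢l  = relocate (subst (λ o → d ∈ root ∷ o) outer≡ (legs⊆outer leg))
      where
        leg : isLegᶜ ps d ≡ true
        leg = trans (sym (isLegᶜ-other d≢b d≢l)) leg′
        relocate : d ∈ (root ∷ A) ++ b ∷ B ++ l ∷ C → d ∈ (root ∷ A) ++ b ∷ C
        relocate d∈ with ∈-++⁻ (root ∷ A) d∈
        ... | inj₁ d∈A         = ∈-++⁺ˡ d∈A
        ... | inj₂ (here refl) = ⊥-elim (d≢b refl)
        ... | inj₂ (there d∈′) with ∈-++⁻ B d∈′
        ...   | inj₁ d∈B          with () ← subst (d ∈_) selB (∈-select⁺ (isLegᶜ ps) d∈B leg)
        ...   | inj₂ (here refl)  = ⊥-elim (d≢l refl)
        ...   | inj₂ (there d∈C)  = ∈-++⁺ʳ (root ∷ A) (there d∈C)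

    consumed : (p : Fin n → Bool) {N : ℕ} → countB {n} p (b ∷ l ∷ []) ≡ 1 →
               countB {n} p (L₁ ++ b ∷ l ∷ L₂) + length ps ≡ N → countB {n} p (L₁ ++ L₂) + length ps′ ≡ N
    consumed p {N} one used = begin
      count (L₁ ++ L₂) + suc (length ps)               ≡⟨ +-suc (count (L₁ ++ L₂)) (length ps) ⟩
      suc (count (L₁ ++ L₂)) + length ps               ≡⟨ cong (λ c → c + count (L₁ ++ L₂) + length ps) one ⟨
      count (b ∷ l ∷ []) + count (L₁ ++ L₂) + length ps ≡⟨ cong (_+ length ps) (countB-extract₂ {n} p L₁ b l L₂) ⟨
      count (L₁ ++ b ∷ l ∷ L₂) + length ps             ≡⟨ used ⟩
      N                                                ∎
      where
        count : List (Fin n) → ℕ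
        count = countB {n} p

    one-leaf : countB {n} (isLeaf T) (b ∷ l ∷ []) ≡ 1
    one-leaf rewrite bud⇒¬leaf bud | leaf = refl

    one-bud : countB {n} (isBud T) (b ∷ l ∷ []) ≡ 1
    one-bud rewrite bud | leaf⇒¬bud leaf = refl

    invariant′ : Invariant ps′ (L₁ ++ L₂)
    invariant′ = record
      { gluing      = isGluing gluing colours-differ
      ; outer       = A ++ b ∷ C
      ; inner       = (l ∷ B) ∷ inner
      ; faces       = faces′
      ; #inner      = cong suc #inner
      ; legs-order  = legs-order′
      ; legs⊆outer  = legs⊆outer′
      ; leaves-used = consumed (isLeaf T) one-leaf leaves-used
      ; buds-used   = consumed (isBud T) one-bud buds-used
      }

  step : ∀ {ps L b l R} → Invariant ps L → findPair T L ≡ just (b , l , R) → root ∈ R →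
         Invariant ((b , l) ∷ ps) R
  step {L = L} I fp root∈R with findPair-just L fp
  ... | L₁ , L₂ , refl , refl , bud , leaf with outer-split I refl (root≢bud I refl root∈R)
  ...   | A , B , C , outer≡ , selA , selB , selC = Step.invariant′ I bud leaf outer≡ selA selB selC

  buds-decrease : ∀ {ps L p R} → Invariant ps L → Invariant (p ∷ ps) R →
                  suc (countB {n} (isBud T) R) ≡ countB {n} (isBud T) L
  buds-decrease {ps} I I′ = +-cancelʳ-≡ (length ps) _ _
    (trans (sym (+-suc _ (length ps))) (trans (Invariant.buds-used I′) (sym (Invariant.buds-used I))))

  loop : ∀ fuel {ps L} → Leaf root → Invariant ps L → countB {n} (isBud T) L ≤ fuel →
         root ∈ proj₂ (matchLoop T fuel L ps) →
         Invariant (proj₁ (matchLoop T fuel L ps)) (proj₂ (matchLoop T fuel L ps)) ×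
         countB {n} (isBud T) (proj₂ (matchLoop T fuel L ps)) ≡ 0
  loop zero                  _         I no-buds _     = I , n≤0⇒n≡0 no-buds
  loop (suc fuel) {ps} {L} root-leaf I buds≤ root∈ with cyclicFind T L in cf
  ... | nothing = I , cyclicFind-nothing⇒no-buds L (L-legs I) (countB-pos {n} (isLeaf T) root∈ root-leaf) cf
  ... | just (b , l , R) with cyclicFind-just L cf
  ...   | inj₁ fp = loop fuel root-leaf I′ (≤-pred (subst (_≤ suc fuel) (sym (buds-decrease I I′)) buds≤)) root∈
    where I′ = step I fp (matchLoop-⊆ fuel R _ root∈)
  -- the root heads L, so a pair wrapping around the end of L would have to match it
  ...   | inj₂ (L′ , refl , R⊆L′) = ⊥-elim (root∉tail I refl (R⊆L′ (matchLoop-⊆ fuel R _ root∈)))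

-- The closure of a balanced tree

σ∘α-injective : ∀ {n} {σ σ⁻¹ α : Fin n → Fin n} → (∀ d → σ⁻¹ (σ d) ≡ d) → (∀ d → α (α d) ≡ d) →
                ∀ {x y} → σ (α x) ≡ σ (α y) → x ≡ y
σ∘α-injective {σ = σ} {σ⁻¹} {α} σ⁻¹-σ α-invol {x} {y} eq = begin
  x                   ≡⟨ α-invol x ⟨
  α (α x)             ≡⟨ cong α (σ⁻¹-σ (α x)) ⟨
  α (σ⁻¹ (σ (α x)))   ≡⟨ cong (λ d → α (σ⁻¹ d)) eq ⟩
  α (σ⁻¹ (σ (α y)))   ≡⟨ cong α (σ⁻¹-σ (α y)) ⟩
  α (α y)             ≡⟨ α-invol y ⟩
  y                   ∎
  where open ≡-Reasoning

Reach-closure : ∀ {n} (T : RawMap n) → (∀ d → RawMap.α T d ≢ d → RawMap.α (closure T) d ≡ RawMap.α T d) →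
                ∀ {d e} → Reach T d e → Reach (closure T) d e
Reach-closure T extends here      = here
Reach-closure T extends (stepσ r) = stepσ (Reach-closure T extends r)
Reach-closure T extends {d} (stepα r) with toSum (RawMap.α T d ≟ d)
... | inj₁ αd≡d = subst (λ x → Reach (closure T) x _) αd≡d (Reach-closure T extends r)
... | inj₂ αd≢d = stepα (subst (λ x → Reach (closure T) x _) (sym (extends d αd≢d)) (Reach-closure T extends r))

module ClosureOfTree {m : ℕ} (T : RawMap (suc m)) (isMap : IsMap T) (tree : nFaces T ≡ 1)
                     (root-leaf : isLeaf T (RawMap.root T) ≡ true) (root-single : RawMap.root T ∈ unmatched T) where
  open RawMap T
  open IsMap isMap
  open Matching T
  open Gluing T
  open PartialClosure T
  open ≡-Reasoning

  open SingleCycle (φ T) (σ∘α-injective {σ = σ} {σ⁻¹} {α} σ⁻¹-σ α-invol) tree root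
    using (orbit; orbit-unique; orbit-complete; orbit-decomposition)

  leaves buds : List (Fin (suc m)) → ℕ
  leaves = countB {suc m} (isLeaf T)
  buds   = countB {suc m} (isBud T)

  initial : Invariant [] (legsInOrder T)
  initial = record
    { gluing      = record { involutive = α-invol ; bipartite = bipartite ; extends = λ _ _ → refl }
    ; outer       = _
    ; inner       = []
    ; faces       = orbit-decomposition
    ; #inner      = refl
    ; legs-order  = refl
    ; legs⊆outer  = λ _ → orbit-complete _
    ; leaves-used = +-identityʳ _
    ; buds-used   = +-identityʳ _
    }

  buds≤darts : buds (legsInOrder T) ≤ suc m
  buds≤darts = ≤-trans (countB≤length {suc m} (isBud T) (legsInOrder T)) (≤-trans (length-select (isLeg T) orbit)
                 (≤-reflexive (trans (length-map _ (upTo (suc m))) (length-upTo (suc m)))))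

  countB-legsInOrder : (p : Fin (suc m) → Bool) → (∀ {d} → p d ≡ true → Leg d) →
                       countB {suc m} p (legsInOrder T) ≡ countB {suc m} p (allFin (suc m))
  countB-legsInOrder p p⇒leg = trans (countB-select {suc m} p (isLeg T) orbit p⇒leg)
    (countB-sameElements {suc m} p orbit-unique (allFin⁺ _) (λ _ → ∈-allFin _) (λ _ → orbit-complete _))

  ps : Pairs
  ps = matchedPairs T

  L : List (Fin (suc m))
  L = unmatched T

  I : Invariant ps L
  I = proj₁ (loop (suc m) root-leaf initial buds≤darts root-single)

  no-buds : buds L ≡ 0
  no-buds = proj₂ (loop (suc m) root-leaf initial buds≤darts root-single)

  open Invariant I

  L-leaves : ∀ {d} → d ∈ L → Leaf d
  L-leaves d∈ with leg⇒leaf⊎bud (All.lookup (L-legs I) d∈)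
  ... | inj₁ leaf = leaf
  ... | inj₂ bud  with () ← trans (sym bud) (countB≡0⇒false {suc m} (isBud T) L no-buds d∈)

  legs-balance : length L + 2 * length ps ≡ length (legsInOrder T)
  legs-balance = begin
    length L + 2 * length ps                       ≡⟨ cong (_+ 2 * length ps) (length≡leaves+buds L (L-legs I)) ⟩
    (leaves L + buds L) + 2 * length ps            ≡⟨ rearrange (leaves L) (buds L) (length ps) ⟩
    (leaves L + length ps) + (buds L + length ps)  ≡⟨ cong₂ _+_ leaves-used buds-used ⟩
    leaves (legsInOrder T) + buds (legsInOrder T)  ≡⟨ length≡leaves+buds (legsInOrder T) (L-legs initial) ⟨
    length (legsInOrder T)                         ∎
    where
      rearrange : ∀ a b c → (a + b) + 2 * c ≡ (a + c) + (b + c)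
      rearrange = solve-∀

  leaves≡charge : ∀ {k} → HasCharge T k → leaves L ≡ k
  leaves≡charge {k} charge = +-cancelʳ-≡ (length ps) _ _ (begin
    leaves L + length ps      ≡⟨ leaves-used ⟩
    leaves (legsInOrder T)    ≡⟨ countB-legsInOrder (isLeaf T) leaf⇒leg ⟩
    nLeaves T                 ≡⟨ charge ⟩
    k + nBuds T               ≡⟨ cong (k +_) (countB-legsInOrder (isBud T) bud⇒leg) ⟨
    k + buds (legsInOrder T)  ≡⟨ cong (k +_) buds-used ⟨
    k + (buds L + length ps)  ≡⟨ cong (λ b → k + (b + length ps)) no-buds ⟩
    k + length ps             ∎)

  C : RawMap (suc m)
  C = closure T

  isLeg-closure : ∀ d → isLeg C d ≡ isLegᶜ ps d
  isLeg-closure d = cong (_== d) (α-closure d)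

  isLeg-closure⇒∈ : ∀ {d} → isLeg C d ≡ true → d ∈ L
  isLeg-closure⇒∈ {d} leg = isLegᶜ⇒∈ I (trans (sym (isLeg-closure d)) leg)

  α-closure-involutive : ∀ d → RawMap.α C (RawMap.α C d) ≡ d
  α-closure-involutive d =
    trans (α-closure _) (trans (cong (αᶜ ps) (α-closure d)) (IsGluing.involutive gluing d))

  α-closure-bipartite : ∀ d → RawMap.α C d ≢ d → white (RawMap.α C d) ≢ white d
  α-closure-bipartite d αd≢d rewrite α-closure d = IsGluing.bipartite gluing d αd≢d

  faces-closure : IsCycleDecomposition (φ C) ((root ∷ outer) ∷ inner)
  faces-closure = decomposition-cong (λ d → cong σ (α-closure d)) faces

  open Orbits (φ C) (σ∘α-injective {σ = σ} {σ⁻¹} {RawMap.α C} σ⁻¹-σ α-closure-involutive)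
    using (cycles≡length; chain-↝; ↝⇒inOrbit)

  legs-outer-closure : ∀ d → RawMap.α C d ≡ d → inOrbit (φ C) root d ≡ true
  legs-outer-closure d αd≡d = ↝⇒inOrbit (chain-↝ outer (All.head (IsCycleDecomposition.isCycle faces-closure))
    (legs⊆outer (trans (sym (isLeg-closure d)) (trans (cong (_== d) αd≡d) (==-refl d)))))

  planar-closure : 2 * (nVertices C + nFaces C) + nLegs C ≡ suc m + 4
  planar-closure = begin
    2 * (nVertices T + nFaces C) + nLegs C             ≡⟨ cong₂ euler nFaces-closure nLegs-closure ⟩
    2 * (nVertices T + suc (length ps)) + length L     ≡⟨ rearrange (nVertices T) (length ps) (length L) ⟩
    2 * (nVertices T + 1) + (length L + 2 * length ps) ≡⟨ cong₂ euler (sym tree) nLegs-tree ⟩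
    2 * (nVertices T + nFaces T) + nLegs T             ≡⟨ planar ⟩
    suc m + 4                                          ∎
    where
      euler : ℕ → ℕ → ℕ
      euler f l = 2 * (nVertices T + f) + l
      nFaces-closure : nFaces C ≡ suc (length ps)
      nFaces-closure = trans (cycles≡length faces-closure) (cong suc #inner)
      nLegs-closure : nLegs C ≡ length L
      nLegs-closure = trans (countB-cong {suc m} (allFin _) isLeg-closure) (countB-isLegᶜ I)
      nLegs-tree : length L + 2 * length ps ≡ nLegs T
      nLegs-tree = trans legs-balance (sym (countB-isLegᶜ initial))
      rearrange : ∀ v p l → 2 * (v + suc p) + l ≡ 2 * (v + 1) + (l + 2 * p)
      rearrange = solve-∀

  isMap-closure : IsMap C
  isMap-closure = record
    { σ⁻¹        = σ⁻¹
    ; σ-σ⁻¹      = σ-σ⁻¹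
    ; σ⁻¹-σ      = σ⁻¹-σ
    ; α-invol    = α-closure-involutive
    ; white-σ    = white-σ
    ; bipartite  = α-closure-bipartite
    ; connected  = λ d e → Reach-closure T (λ d αd≢d → trans (α-closure d) (IsGluing.extends gluing d αd≢d))
                                         (connected d e)
    ; planar     = planar-closure
    ; root-leg   = trans (α-closure root) (==⇒≡ (L-isLegᶜ I root-single))
    ; legs-outer = legs-outer-closure
    }

  isLeaf-closure⇔∈ : ∀ {d} → (isLeaf C d ≡ true → d ∈ L) × (d ∈ L → isLeaf C d ≡ true)
  isLeaf-closure⇔∈ {d} =
    leaf⇒∈ , λ d∈ → cong₂ _∧_ (trans (isLeg-closure d) (L-isLegᶜ I d∈)) (leaf⇒white (L-leaves d∈))
    where
      leaf⇒∈ : isLeaf C d ≡ true → d ∈ L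
      leaf⇒∈ _ with isLeg C d in leg
      ... | true = isLeg-closure⇒∈ leg

  nLeaves-closure : ∀ {k} → HasCharge T k → nLeaves C ≡ k
  nLeaves-closure {k} charge = begin
    nLeaves C           ≡⟨ countB≡length {suc m} (isLeaf C) (allFin⁺ _) (L-unique I)
                             (λ d∈ → ∈-allFin _ , proj₂ isLeaf-closure⇔∈ d∈)
                             (λ _ → proj₁ isLeaf-closure⇔∈) ⟩
    length L            ≡⟨ length≡leaves+buds L (L-legs I) ⟩
    leaves L + buds L   ≡⟨ cong₂ _+_ (leaves≡charge charge) no-buds ⟩
    k + 0               ≡⟨ +-identityʳ k ⟩
    k                   ∎

  nBuds-closure : nBuds C ≡ 0
  nBuds-closure = countB-none {suc m} (isBud C) (allFin _) (λ {d} _ → not-bud d)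
    where
      not-bud : ∀ d → isBud C d ≡ false
      not-bud d with isLeg C d in leg
      ... | false = refl
      ... | true rewrite leaf⇒white (L-leaves (isLeg-closure⇒∈ leg)) = refl

  isKLegMap : ∀ {k} → HasCharge T k → IsKLegMap C k
  isKLegMap charge = isMap-closure , nLeaves-closure charge , nBuds-closure , proj₂ isLeaf-closure⇔∈ root-single

proposition5 : (n : ℕ) (T : RawMap n) (k : ℕ) → 1 ≤ k
    → IsTree T → HasCharge T k → Balanced T
    → IsKLegMap (closure T) k × SameDegDist T (closure T)
proposition5 zero    T _ _ _                _      _                           with () ← RawMap.root T
proposition5 (suc m) T _ _ (isMap , oneFace) charge (root-leaf , root-single) =
  ClosureOfTree.isKLegMap T isMap oneFace root-leaf root-single charge , λ _ _ → refl
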